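{- In a strong labeling of a quadrangulation, walking along an interior (bounded) face in clockwise order, the labels change precisely when moving from a black to a white vertex; that is, if $w,w'$ are consecutive vertices in the clockwise boundary walk of a bounded face, the labels of the angles of that face at $w$ and $w'$ differ if and only if $w$ is black and $w'$ is white.
   Context: A quadrangulation is a plane graph that is a maximal bipartite plane graph; all faces, including the outer one, are bounded by 4-cycles. Its vertices are properly colored black and white. An angle is a corner of a face at a vertex; each edge has four incident angles (two at each endpoint, one on each side). A strong labeling of $Q$ is a map from angles to $\{0,1\}$ with: (G0) the two black outer vertices are named $s_0,s_1$ and all angles at $s_i$ are labeled $i$; (G1) for each $v\notin\{s_0,s_1\}$ the labels around $v$ form a non-empty interval of 1s and a non-empty interval of 0s; (G2) for each edge, the incident labels coincide at one endpoint and differ at the other; (G3$^+_Q$) labels in each bounded face are $0011$ cyclically, and labels of the outer face read clockwise from $s_0$ are $0011$. -}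

module Defs where

open import Data.Nat using (ℕ; zero; suc; _+_; _*_; _≤_; _≤?_)
open import Data.Fin using (Fin; toℕ) renaming (zero to f0; suc to fs)
open import Data.Fin.Properties using (all?)
open import Data.List using (List; length; filter; allFin)
open import Data.Product using (Σ; ∃; _×_; _,_)
open import Data.Sum using (_⊎_)
open import Relation.Nullary using (¬_; Dec)
open import Relation.Binary.PropositionalEquality using (_≡_; _≢_)

iter : {A : Set} → (A → A) → ℕ → A → A
iter f zero    x = x
iter f (suc k) x = f (iter f k x)

Xor : Set → Set → Set
Xor P Q = (P × ¬ Q) ⊎ (¬ P × Q)

Label : Set
Label = Fin 2

L0 L1 : Label
L0 = f0
L1 = fs f0

-- x is the least element (w.r.t. toℕ) of its p-orbit (orbits have size ≤ n)
IsOrbitMin : {n : ℕ} → (Fin n → Fin n) → Fin n → Set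
IsOrbitMin {n} p x = (k : Fin n) → toℕ x ≤ toℕ (iter p (toℕ k) x)

isOrbitMin? : {n : ℕ} (p : Fin n → Fin n) (x : Fin n) → Dec (IsOrbitMin p x)
isOrbitMin? {n} p x = all? {n = n} {P = λ k → toℕ x ≤ toℕ (iter p (toℕ k) x)}
                           (λ k → toℕ x ≤? toℕ (iter p (toℕ k) x))

numOrbits : {n : ℕ} → (Fin n → Fin n) → ℕ
numOrbits {n} p = length (filter (isOrbitMin? p) (allFin n))

-- Darts are Fin n.  σ is the COUNTERCLOCKWISE
-- rotation of darts around their tail vertex, α the edge involution
-- (reverses a dart), φ = σ ∘ α is the face permutation.  With this
-- convention φ walks every face keeping the face on its right, i.e.
-- bounded faces are traversed CLOCKWISE and the outer face
-- counterclockwise.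
-- Angle convention: dart x represents the angle (corner) at tail(x)
-- swept counterclockwise from σ⁻¹ x to x.  This is a bijection between
-- darts and angles; the angle of x lies in the face (φ-orbit) of x.

data Reach {n : ℕ} (σ α : Fin n → Fin n) : Fin n → Fin n → Set where
  here  : ∀ {x} → Reach σ α x x
  viaσ  : ∀ {x y} → Reach σ α (σ x) y → Reach σ α x y
  viaα  : ∀ {x y} → Reach σ α (α x) y → Reach σ α x y

record PlaneMap (n : ℕ) : Set where
  field
    σ      : Fin n → Fin n
    σ⁻¹    : Fin n → Fin n
    σσ⁻¹   : ∀ x → σ (σ⁻¹ x) ≡ x
    σ⁻¹σ   : ∀ x → σ⁻¹ (σ x) ≡ x
    α      : Fin n → Fin n
    αα     : ∀ x → α (α x) ≡ x
    α-free : ∀ x → α x ≢ x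
    connected : ∀ x y → Reach σ α x y
  φ : Fin n → Fin n
  φ x = σ (α x)
  field
    -- genus 0 (Euler's formula V - E + F = 2, with E = n/2)
    euler : 2 * numOrbits σ + 2 * numOrbits φ ≡ n + 4

  SameVertex : Fin n → Fin n → Set
  SameVertex x y = ∃ λ k → iter σ k x ≡ y

  SameFace : Fin n → Fin n → Set
  SameFace x y = ∃ λ k → iter φ k x ≡ y

  IsDegree : Fin n → ℕ → Set
  IsDegree x d = (1 ≤ d) × (iter σ d x ≡ x) × (∀ j → 1 ≤ j → suc j ≤ d → iter σ j x ≢ x)

data Color : Set where
  black white : Color

data Cyc0011 : Label → Label → Label → Label → Set where
  r0 : Cyc0011 L0 L0 L1 L1
  r1 : Cyc0011 L0 L1 L1 L0
  r2 : Cyc0011 L1 L1 L0 L0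
  r3 : Cyc0011 L1 L0 L0 L1

record Quadrangulation (n : ℕ) : Set where
  field
    M : PlaneMap n
  open PlaneMap M public
  field
    -- proper black/white colouring of the vertices (colour of a dart =
    -- colour of its tail vertex)
    color   : Fin n → Color
    color-σ : ∀ x → color (σ x) ≡ color x
    color-α : ∀ x → color (α x) ≢ color x
    -- simple graph: no parallel edges (loops excluded by the colouring)
    simple  : ∀ x y → SameVertex x y → SameVertex (α x) (α y) → x ≡ y
    face-len  : ∀ x → iter φ 4 x ≡ x
    face-cyc  : ∀ x → (i j : Fin 4) → i ≢ j →
                ¬ SameVertex (iter φ (toℕ i) x) (iter φ (toℕ j) x)
    outer   : Fin n
    outer-black : color outer ≡ black

  AtS0 AtS1 : Fin n → Set
  AtS0 x = SameVertex outer x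
  AtS1 x = SameVertex (iter φ 2 outer) x

  Bounded : Fin n → Set
  Bounded x = ¬ SameFace outer x

record StrongLabeling {n : ℕ} (Q : Quadrangulation n) (ℓ : Fin n → Label) : Set where
  open Quadrangulation Q
  field
    G0₀ : ∀ x → AtS0 x → ℓ x ≡ L0
    G0₁ : ∀ x → AtS1 x → ℓ x ≡ L1
    -- around v ∉ {s₀,s₁}: cyclic sequence of labels (in rotation order)
    -- is a non-empty interval of 1s followed by a non-empty interval of 0s
    G1  : ∀ x → ¬ AtS0 x → ¬ AtS1 x →
          Σ (Fin n) λ y → SameVertex x y ×
          Σ ℕ λ d → IsDegree y d ×
          Σ ℕ λ a → (1 ≤ a) × (suc a ≤ d) ×
          (∀ i → suc i ≤ d → (ℓ (iter σ i y) ≡ L1 → suc i ≤ a) × (suc i ≤ a → ℓ (iter σ i y) ≡ L1))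
    -- edge {x, α x}: the two angles at tail(x) incident to it are the
    -- angles of x and σ x; labels coincide at exactly one endpoint
    G2  : ∀ x → Xor (ℓ x ≡ ℓ (σ x)) (ℓ (α x) ≡ ℓ (σ (α x)))
    G3  : ∀ x → Bounded x → Cyc0011 (ℓ x) (ℓ (φ x)) (ℓ (iter φ 2 x)) (ℓ (iter φ 3 x))
    -- outer face read clockwise from s₀ (= reverse φ-order):
    -- outer, φ³ outer, φ² outer, φ outer  reads 0 0 1 1
    G3o : (ℓ outer ≡ L0) × (ℓ (iter φ 3 outer) ≡ L0) × (ℓ (iter φ 2 outer) ≡ L1) × (ℓ (φ outer) ≡ L1)

-- Call a dart y a change if the labels of its angle and of the next angle φ y of its face differ.
-- Along every face changes alternate: for bounded faces by (G3), for the outer face by (G3⁺).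
-- Across every edge they alternate as well: by (G2) exactly one endpoint of y sees a label change,
-- and rearranging the four labels involved shows that y is a change iff α y is not.
-- Colours alternate under φ and α in the same way, so "y is a change iff y is black" is preserved
-- by φ and α, hence by σ, and by connectivity it spreads from the outer dart at s₀, where it holds.

module Submission where

open import Defs
open import Data.Nat using (ℕ)
open import Data.Fin using (Fin; zero; suc)
open import Data.Bool using (Bool; true; false; not; _xor_)
open import Data.Bool.Properties using (xor-same; not-involutive; not-injective) renaming (_≟_ to _≟ᵇ_)
open import Data.Product using (_×_; _,_; proj₁)
open import Data.Sum using (inj₁; inj₂)
open import Function using (id; _∘_)
open import Function.Bundles using (_⇔_; mk⇔)
import Function.Properties.Equivalence as ⇔
open import Relation.Nullary using (contradiction)
open import Relation.Nullary.Decidable using (decidable-stable)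
open import Relation.Binary.PropositionalEquality using (_≡_; _≢_; refl; sym; trans; cong; subst)

xor-exchange : ∀ p q r s → p xor q ≡ not (r xor s) → r xor q ≡ not (p xor s)
xor-exchange false q false s e = e
xor-exchange false q true  s e = trans (cong not e) (not-involutive (not s))
xor-exchange true  q false s e = trans (not-injective e) (sym (not-involutive s))
xor-exchange true  q true  s e = e

flips-preserve-≡ : ∀ {p q p′ q′} → p′ ≡ not p → q′ ≡ not q → p ≡ q → p′ ≡ q′
flips-preserve-≡ refl refl refl = refl

bit : Label → Bool
bit zero       = false
bit (suc zero) = true

_≠ᵇ_ : Label → Label → Bool
a ≠ᵇ b = bit a xor bit b

≢⇒≠ᵇ : ∀ {a b} → a ≢ b → a ≠ᵇ b ≡ true
≢⇒≠ᵇ {zero}     {zero}     a≢b = contradiction refl a≢b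
≢⇒≠ᵇ {zero}     {suc zero} _   = refl
≢⇒≠ᵇ {suc zero} {zero}     _   = refl
≢⇒≠ᵇ {suc zero} {suc zero} a≢b = contradiction refl a≢b

≠ᵇ⇒≢ : ∀ {a b} → a ≠ᵇ b ≡ true → a ≢ b
≠ᵇ⇒≢ {a} e refl with () ← trans (sym (xor-same (bit a))) e

≢⇔≠ᵇ : ∀ {a b} → (a ≢ b) ⇔ (a ≠ᵇ b ≡ true)
≢⇔≠ᵇ = mk⇔ ≢⇒≠ᵇ ≠ᵇ⇒≢

Xor-≡⇒≠ᵇ : ∀ {a b c d} → Xor (a ≡ b) (c ≡ d) → a ≠ᵇ b ≡ not (c ≠ᵇ d)
Xor-≡⇒≠ᵇ {a} (inj₁ (refl , c≢d)) rewrite xor-same (bit a) | ≢⇒≠ᵇ c≢d = refl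
Xor-≡⇒≠ᵇ {c = c} (inj₂ (a≢b , refl)) rewrite xor-same (bit c) | ≢⇒≠ᵇ a≢b = refl

Cyc0011-rotate : ∀ {a b c d} → Cyc0011 a b c d → Cyc0011 b c d a
Cyc0011-rotate r0 = r1
Cyc0011-rotate r1 = r2
Cyc0011-rotate r2 = r3
Cyc0011-rotate r3 = r0

Cyc0011-alternates : ∀ {a b c d} → Cyc0011 a b c d → b ≠ᵇ c ≡ not (a ≠ᵇ b)
Cyc0011-alternates r0 = refl
Cyc0011-alternates r1 = refl
Cyc0011-alternates r2 = refl
Cyc0011-alternates r3 = refl

isBlack : Color → Bool
isBlack black = true
isBlack white = false

≢⇒isBlack-not : ∀ {c d} → c ≢ d → isBlack c ≡ not (isBlack d)
≢⇒isBlack-not {black} {black} c≢d = contradiction refl c≢d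
≢⇒isBlack-not {black} {white} _   = refl
≢⇒isBlack-not {white} {black} _   = refl
≢⇒isBlack-not {white} {white} c≢d = contradiction refl c≢d

isBlack≡true⇒black : ∀ {c} → isBlack c ≡ true → c ≡ black
isBlack≡true⇒black {black} _ = refl

isBlack⇔black : ∀ {c} → (isBlack c ≡ true) ⇔ (c ≡ black)
isBlack⇔black = mk⇔ isBlack≡true⇒black λ { refl → refl }

≢black⇒white : ∀ {c} → c ≢ black → c ≡ white
≢black⇒white {black} c≢black = contradiction refl c≢black
≢black⇒white {white} _       = refl

iter-preserves : ∀ {A : Set} {f : A → A} (P : A → Set) → (∀ {y} → P y → P (f y)) →
                 ∀ {x} k → P x → P (iter f k x)
iter-preserves P Pf ℕ.zero    = id
iter-preserves P Pf (ℕ.suc k) = Pf ∘ iter-preserves P Pf k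

Reach-preserves : ∀ {n} {σ α : Fin n → Fin n} (P : Fin n → Set) →
                  (∀ {y} → P y → P (σ y)) → (∀ {y} → P y → P (α y)) →
                  ∀ {x y} → Reach σ α x y → P x → P y
Reach-preserves P Pσ Pα here     = id
Reach-preserves P Pσ Pα (viaσ r) = Reach-preserves P Pσ Pα r ∘ Pσ
Reach-preserves P Pσ Pα (viaα r) = Reach-preserves P Pσ Pα r ∘ Pα

module _ {n : ℕ} (M : PlaneMap n) where
  open PlaneMap M

  α-φ-closed⇒universal : (P : Fin n → Set) → (∀ {y} → P y → P (α y)) → (∀ {y} → P y → P (φ y)) →
                         ∀ {x} y → P x → P y
  α-φ-closed⇒universal P Pα Pφ y = Reach-preserves P Pσ Pα (connected _ y)
    where
    Pσ : ∀ {y} → P y → P (σ y)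
    Pσ {y} = subst P (cong σ (αα y)) ∘ Pφ ∘ Pα

module _ {n : ℕ} (Q : Quadrangulation n) where
  open Quadrangulation Q

  color-φ : ∀ y → color (φ y) ≢ color y
  color-φ y = subst (_≢ color y) (sym (color-σ (α y))) (color-α y)

  black⇔black×φ-white : ∀ {x} → (color x ≡ black) ⇔ (color x ≡ black × color (φ x) ≡ white)
  black⇔black×φ-white {x} = mk⇔ (λ x-black → x-black , φx-white x-black) proj₁
    where
    φx-white : color x ≡ black → color (φ x) ≡ white
    φx-white x-black = ≢black⇒white (subst (color (φ x) ≢_) x-black (color-φ x))

module _ {n : ℕ} {Q : Quadrangulation n} {ℓ : Fin n → Label} (S : StrongLabeling Q ℓ) where
  open Quadrangulation Q
  open StrongLabeling S

  changes : Fin n → Bool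
  changes y = ℓ y ≠ᵇ ℓ (φ y)

  changes-α : ∀ y → changes (α y) ≡ not (changes y)
  changes-α y rewrite αα y =
    xor-exchange (bit (ℓ y)) (bit (ℓ (σ y))) (bit (ℓ (α y))) (bit (ℓ (φ y))) (Xor-≡⇒≠ᵇ (G2 y))

  LabelsCyc0011 : Fin n → Set
  LabelsCyc0011 y = Cyc0011 (ℓ y) (ℓ (φ y)) (ℓ (φ (φ y))) (ℓ (φ (φ (φ y))))

  LabelsCyc0011-φ : ∀ {y} → LabelsCyc0011 y → LabelsCyc0011 (φ y)
  LabelsCyc0011-φ {y} c =
    subst (λ z → Cyc0011 (ℓ (φ y)) (ℓ (φ (φ y))) (ℓ (φ (φ (φ y)))) (ℓ z)) (sym (face-len y)) (Cyc0011-rotate c)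

  outer-LabelsCyc0011 : LabelsCyc0011 outer
  outer-LabelsCyc0011 with G3o
  ... | ℓ₀ , ℓ₃ , ℓ₂ , ℓ₁ rewrite ℓ₀ | ℓ₁ | ℓ₂ | ℓ₃ = r1

  outer-face-LabelsCyc0011 : ∀ {y} → SameFace outer y → LabelsCyc0011 y
  outer-face-LabelsCyc0011 (k , refl) = iter-preserves LabelsCyc0011 LabelsCyc0011-φ k outer-LabelsCyc0011

  -- Bounded y is ¬ SameFace outer y, so the split into bounded and outer darts is only
  -- available because the goal is decidable.
  changes-φ : ∀ y → changes (φ y) ≡ not (changes y)
  changes-φ y = decidable-stable (changes (φ y) ≟ᵇ not (changes y)) λ ¬alt →
    ¬alt (Cyc0011-alternates (G3 y (¬alt ∘ Cyc0011-alternates ∘ outer-face-LabelsCyc0011)))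

  changes-outer : changes outer ≡ isBlack (color outer)
  changes-outer with G3o
  ... | ℓ₀ , _ , _ , ℓ₁ rewrite ℓ₀ | ℓ₁ | outer-black = refl

  changes≡isBlack : ∀ y → changes y ≡ isBlack (color y)
  changes≡isBlack y = α-φ-closed⇒universal M (λ z → changes z ≡ isBlack (color z))
    (flips-preserve-≡ (changes-α _) (≢⇒isBlack-not (color-α _)))
    (flips-preserve-≡ (changes-φ _) (≢⇒isBlack-not (color-φ Q _)))
    y changes-outer

-- The conclusion holds on the outer face too.
lemma1 : {n : ℕ} (Q : Quadrangulation n) (ℓ : Fin n → Label) →
         StrongLabeling Q ℓ →
         ∀ x → Quadrangulation.Bounded Q x →
         (ℓ x ≢ ℓ (Quadrangulation.φ Q x)) ⇔
           ((Quadrangulation.color Q x ≡ black) × (Quadrangulation.color Q (Quadrangulation.φ Q x) ≡ white))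
lemma1 Q ℓ S x _ =
  ⇔.trans ≢⇔≠ᵇ (⇔.trans changes⇔black (⇔.trans isBlack⇔black (black⇔black×φ-white Q)))
  where
  changes⇔black : (changes S x ≡ true) ⇔ (isBlack (Quadrangulation.color Q x) ≡ true)
  changes⇔black = mk⇔ (trans (sym (changes≡isBlack S x))) (trans (changes≡isBlack S x))
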